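{- Let $n \geq 6$ be an integer and let $G$ be a graph having a connected component on $n$ vertices with minimum degree at least $n - 2$. If $T$ is a tree on at most $n$ vertices which is not isomorphic to $K_{1, n-1}$, then $G$ contains a subgraph isomorphic to $T$. -}

module Defs where

open import Level using (Level; _⊔_; 0ℓ)
open import Data.Nat using (ℕ; zero; suc; _∸_; _≤_)
open import Data.Fin using (Fin; zero; suc; inject₁; fromℕ)
open import Data.Product using (Σ; ∃; _×_; _,_; ∃-syntax)
open import Data.Empty using (⊥)
open import Relation.Nullary using (¬_)
open import Relation.Binary.PropositionalEquality using (_≡_; _≢_)
open import Relation.Binary.Construct.Closure.ReflexiveTransitive using (Star)
open import Function.Definitions using (Injective)
open import Function.Bundles using (_⇔_)

record Graph (ℓv ℓe : Level) : Set (Level.suc (ℓv ⊔ ℓe)) where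
  field
    V      : Set ℓv
    Adj    : V → V → Set ℓe
    sym    : ∀ {u v} → Adj u v → Adj v u
    irrefl : ∀ {v} → ¬ Adj v v
open Graph public

Connected : ∀ {ℓv ℓe} (G : Graph ℓv ℓe) → V G → V G → Set (ℓv ⊔ ℓe)
Connected G = Star (Adj G)

record FinGraph (m : ℕ) : Set₁ where
  field
    adj    : Fin m → Fin m → Set
    sym    : ∀ {i j} → adj i j → adj j i
    irrefl : ∀ {i} → ¬ adj i i
open FinGraph public

toGraph : ∀ {m} → FinGraph m → Graph 0ℓ 0ℓ
toGraph {m} T = record { V = Fin m ; Adj = adj T ; sym = sym T ; irrefl = irrefl T }

-- A cycle of length k+3: distinct vertices c 0,...,c (k+2), consecutive ones
-- adjacent, and the last adjacent to the first.
HasCycle : ∀ {ℓv ℓe} (G : Graph ℓv ℓe) → Set (ℓv ⊔ ℓe)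
HasCycle G =
  ∃[ k ] Σ (Fin (suc (suc (suc k))) → V G) λ c →
    Injective _≡_ _≡_ c
    × (∀ (i : Fin (suc (suc k))) → Adj G (c (inject₁ i)) (c (suc i)))
    × Adj G (c (fromℕ (suc (suc k)))) (c zero)

IsTree : ∀ {m} → FinGraph m → Set
IsTree {m} T =
  (0 Data.Nat.< m)
  × (∀ i j → Connected (toGraph T) i j)
  × ¬ HasCycle (toGraph T)
  where import Data.Nat

_≅_ : ∀ {m n} → FinGraph m → FinGraph n → Set
_≅_ {m} {n} T S = Σ (Fin m → Fin n) λ f → Σ (Fin n → Fin m) λ g →
  (∀ i → g (f i) ≡ i) × (∀ j → f (g j) ≡ j)
  × (∀ i j → adj T i j ⇔ adj S (f i) (f j))

StarAdj : ∀ {n} → Fin n → Fin n → Set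
StarAdj zero    zero    = ⊥
StarAdj zero    (suc _) = Data.Unit.⊤ where import Data.Unit
StarAdj (suc _) zero    = Data.Unit.⊤ where import Data.Unit
StarAdj (suc _) (suc _) = ⊥

Star-K1 : (n : ℕ) → FinGraph n
Star-K1 n = record { adj = StarAdj ; sym = s ; irrefl = r }
  where
  s : ∀ {i j : Fin n} → StarAdj i j → StarAdj j i
  s {zero} {suc _} p = p
  s {suc _} {zero} p = p
  r : ∀ {i : Fin n} → ¬ StarAdj i i
  r {zero} ()
  r {suc _} ()

ContainsCopy : ∀ {ℓv ℓe m} (G : Graph ℓv ℓe) → FinGraph m → Set (ℓv ⊔ ℓe)
ContainsCopy G T = Σ (Fin _ → V G) λ φ →
  Injective _≡_ _≡_ φ × (∀ i j → adj T i j → Adj G (φ i) (φ j))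

-- G has a connected component on exactly n vertices (n ≥ 1), listed
-- bijectively by f : Fin n → V, in which every vertex has degree ≥ d
-- (i.e. at least d distinct neighbours; all neighbours of a component
-- vertex lie in the component).
ComponentMinDeg : ∀ {ℓv ℓe} (G : Graph ℓv ℓe) (n d : ℕ) → Set (ℓv ⊔ ℓe)
ComponentMinDeg G zero d = Data.Empty.Polymorphic.⊥ where import Data.Empty.Polymorphic
ComponentMinDeg G (suc n') d = Σ (Fin n → V G) λ f →
    Injective _≡_ _≡_ f
    × (∀ v → (∃[ i ] f i ≡ v) ⇔ Connected G (f zero) v)
    × (∀ v → (∃[ i ] f i ≡ v) →
         Σ (Fin d → V G) λ nb → Injective _≡_ _≡_ nb × (∀ k → Adj G v (nb k)))
  where n = suc n'

{-# OPTIONS --safe #-}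
-- Listing the component as Fin n, every vertex is adjacent to all but at most one other
-- vertex: the complement of the component has maximum degree at most one.  Growing a tree
-- from a root one vertex at a time, acyclicity makes each new vertex adjacent to exactly one
-- earlier vertex u.  While two host vertices are unused, one of them is adjacent to the image
-- of u, so every tree on fewer than n vertices embeds greedily.  A tree on n vertices that is
-- not a star has leaves ℓ and w hanging from distinct vertices p and q; embed the rest
-- greedily and send ℓ and w to the two remaining host vertices s and t: as the complement is
-- a matching, s ~ φ p and t ~ φ q, or t ~ φ p and s ~ φ q.
module Submission where

open import Defs
open import Level using (Level)
open import Data.Nat using (ℕ; zero; suc; _+_; _≤_; _<_; _∸_; s≤s)
import Data.Nat.Properties as ℕ
open import Data.Fin as Fin using (Fin; zero; suc; inject₁; fromℕ; opposite)
import Data.Fin.Properties as Fin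
open import Data.Fin.Permutation.Components using (transpose; transpose-inverse)
open import Data.Vec.Functional using (Vector; updateAt) renaming (_∷_ to _∷ᶠ_)
open import Data.Vec.Functional.Properties using (updateAt-updates; updateAt-minimal)
open import Data.List using (List; _∷_; [_]; length; lookup; map)
open import Data.List.Properties using (length-map)
open import Data.List.Membership.Propositional using (_∈_; _∉_)
open import Data.List.Membership.Propositional.Properties using (∈-lookup; ∈-map⁺)
open import Data.List.Relation.Binary.Subset.Propositional using (_⊆_)
open import Data.List.Relation.Unary.Any as Any using (here; there)
open import Data.List.Relation.Unary.Any.Properties using (lookup-index)
open import Data.List.Relation.Unary.All as All using ([])
open import Data.List.Relation.Unary.All.Properties using (¬Any⇒All¬)
open import Data.List.Relation.Unary.AllPairs using ([]; _∷_)
open import Data.List.Relation.Unary.Unique.Propositional using (Unique)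
open import Data.Product using (Σ; ∃; ∃₂; _×_; _,_; proj₁; proj₂)
open import Data.Sum as Sum using (_⊎_; inj₁; inj₂)
open import Data.Unit using (tt)
open import Relation.Nullary using (¬_; Dec; yes; no; contradiction)
open import Relation.Nullary.Decidable using (_⊎-dec_)
open import Relation.Binary.PropositionalEquality using (_≡_; _≢_; ≢-sym; refl; trans; cong; subst)
import Relation.Binary.PropositionalEquality as ≡
open import Relation.Binary.Construct.Closure.ReflexiveTransitive using (Star; ε; _◅_; _◅◅_)
open import Function using (_∘_; const; id)
open import Function.Definitions using (Injective)
open import Function.Bundles using (_⇔_; mk⇔; Equivalence)

∷ᶠ-injective : ∀ {a} {A : Set a} {n} {x : A} {xs : Vector A n} →
              (∀ i → xs i ≢ x) → Injective _≡_ _≡_ xs → Injective _≡_ _≡_ (x ∷ᶠ xs)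
∷ᶠ-injective xs≢x xs-inj {zero}  {zero}  _  = refl
∷ᶠ-injective xs≢x xs-inj {zero}  {suc j} eq = contradiction (≡.sym eq) (xs≢x j)
∷ᶠ-injective xs≢x xs-inj {suc i} {zero}  eq = contradiction eq (xs≢x i)
∷ᶠ-injective xs≢x xs-inj {suc i} {suc j} eq = cong suc (xs-inj eq)

lookup-injective : ∀ {a} {A : Set a} {xs : List A} → Unique xs → Injective _≡_ _≡_ (lookup xs)
lookup-injective {xs = _ ∷ _} (_      ∷ _) {zero}  {zero}  _  = refl
lookup-injective {xs = _ ∷ _} (x≢xs ∷ _) {zero}  {suc j} eq = contradiction eq (All.lookup x≢xs (∈-lookup j))
lookup-injective {xs = _ ∷ _} (x≢xs ∷ _) {suc i} {zero}  eq =
  contradiction (≡.sym eq) (All.lookup x≢xs (∈-lookup i))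
lookup-injective {xs = _ ∷ _} (_      ∷ u) {suc i} {suc j} eq = cong suc (lookup-injective u eq)

∉⇒Unique-∷ : ∀ {a} {A : Set a} {x : A} {xs} → x ∉ xs → Unique xs → Unique (x ∷ xs)
∉⇒Unique-∷ {xs = xs} x∉xs u = ¬Any⇒All¬ xs x∉xs ∷ u

module _ {m : ℕ} where

  open import Data.List.Membership.DecPropositional (Fin._≟_ {m}) using (_∈?_)

  unique⇒length≤ : {xs : List (Fin m)} → Unique xs → length xs ≤ m
  unique⇒length≤ u = Fin.injective⇒≤ (lookup-injective u)

  covering⇒length≥ : {xs : List (Fin m)} → (∀ x → x ∈ xs) → m ≤ length xs
  covering⇒length≥ {xs} xs∋ = Fin.injective⇒≤ index-injective
    where
    index-injective : Injective _≡_ _≡_ (λ x → Any.index (xs∋ x))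
    index-injective {x} {y} eq =
      trans (lookup-index (xs∋ x)) (trans (cong (lookup xs) eq) (≡.sym (lookup-index (xs∋ y))))

  ∃∉ : (xs : List (Fin m)) → length xs < m → ∃ (_∉ xs)
  ∃∉ xs |xs|<m with Fin.all? (_∈? xs)
  ... | yes xs∋ = contradiction (covering⇒length≥ xs∋) (ℕ.<⇒≱ |xs|<m)
  ... | no ¬xs∋ = Fin.¬∀⟶∃¬ m (_∈ xs) (_∈? xs) ¬xs∋

  ∃₂∉ : (xs : List (Fin m)) → 2 + length xs ≤ m → ∃₂ λ x y → x ≢ y × x ∉ xs × y ∉ xs
  ∃₂∉ xs bound with ∃∉ xs (ℕ.<⇒≤ bound)
  ... | x , x∉xs with ∃∉ (x ∷ xs) bound
  ... | y , y∉x∷xs = x , y , (λ x≡y → y∉x∷xs (here (≡.sym x≡y))) , x∉xs , y∉x∷xs ∘ there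

StarAdj⇔ : ∀ {n} {a b : Fin (suc n)} → StarAdj a b ⇔ (a ≢ b × (a ≡ zero ⊎ b ≡ zero))
StarAdj⇔ = mk⇔ to from
  where
  to : ∀ {n} {a b : Fin (suc n)} → StarAdj a b → a ≢ b × (a ≡ zero ⊎ b ≡ zero)
  to {a = zero}  {suc _} _ = (λ ()) , inj₁ refl
  to {a = suc _} {zero}  _ = (λ ()) , inj₂ refl
  from : ∀ {n} {a b : Fin (suc n)} → a ≢ b × (a ≡ zero ⊎ b ≡ zero) → StarAdj a b
  from {a = zero}  {zero}  (0≢0 , _)  = 0≢0 refl
  from {a = zero}  {suc _} _          = tt
  from {a = suc _} {zero}  _          = tt
  from {a = suc _} {suc _} (_ , inj₁ ())
  from {a = suc _} {suc _} (_ , inj₂ ())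

centred⇒≅star : ∀ {n} (T : FinGraph (suc n)) (r : Fin (suc n)) →
                (∀ {x} → x ≢ r → adj T x r) → (∀ {a b} → adj T a b → a ≡ r ⊎ b ≡ r) →
                T ≅ Star-K1 (suc n)
centred⇒≅star T r spokes touching =
  σ , σ⁻¹ , (λ _ → transpose-inverse zero r) , (λ _ → transpose-inverse r zero) ,
  λ i j → mk⇔ (to i j) (from i j)
  where
  σ σ⁻¹ : Fin _ → Fin _
  σ   = transpose r zero
  σ⁻¹ = transpose zero r
  -- σ⁻¹ zero reduces to r, which is all σ-centre and σ-centre⁻¹ need.
  σ-injective : Injective _≡_ _≡_ σ
  σ-injective {i} {j} eq =
    trans (≡.sym (transpose-inverse zero r)) (trans (cong σ⁻¹ eq) (transpose-inverse zero r))
  σ-centre : ∀ {i} → i ≡ r → σ i ≡ zero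
  σ-centre refl = transpose-inverse r zero
  σ-centre⁻¹ : ∀ {i} → σ i ≡ zero → i ≡ r
  σ-centre⁻¹ σi≡0 = trans (≡.sym (transpose-inverse zero r)) (cong σ⁻¹ σi≡0)
  to : ∀ i j → adj T i j → StarAdj (σ i) (σ j)
  to i j i~j = Equivalence.from StarAdj⇔
    ( (λ σi≡σj → FinGraph.irrefl T (subst (adj T i) (≡.sym (σ-injective σi≡σj)) i~j))
    , Sum.map σ-centre σ-centre (touching i~j))
  from : ∀ i j → StarAdj (σ i) (σ j) → adj T i j
  from i j σi~σj with Equivalence.to StarAdj⇔ σi~σj
  ... | σi≢σj , inj₁ σi≡0 with refl ← σ-centre⁻¹ {i} σi≡0 =
    FinGraph.sym T (spokes λ { refl → σi≢σj refl })
  ... | σi≢σj , inj₂ σj≡0 with refl ← σ-centre⁻¹ {j} σj≡0 = spokes λ { refl → σi≢σj refl }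

module Growths {m : ℕ} (T : FinGraph m) where

  open import Data.List.Membership.DecPropositional (Fin._≟_ {m}) using (_∈?_)

  infix 4 _~_
  _~_ : Fin m → Fin m → Set
  _~_ = adj T

  record Path (vs : List (Fin m)) (a b : Fin m) : Set where
    constructor path
    field
      {len}       : ℕ
      vertex      : Fin (suc len) → Fin m
      injective   : Injective _≡_ _≡_ vertex
      consecutive : ∀ (i : Fin len) → vertex (inject₁ i) ~ vertex (suc i)
      start       : vertex zero ≡ a
      end         : vertex (fromℕ len) ≡ b
      inside      : ∀ i → vertex i ∈ vs

  trivial-path : ∀ {vs a} → a ∈ vs → Path vs a a
  trivial-path {a = a} a∈vs =
    path {len = 0} (const a) (λ { {zero} {zero} _ → refl ; {suc ()} ; {_} {suc ()} })
         (λ ()) refl refl (const a∈vs)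

  widen : ∀ {vs ws a b} → vs ⊆ ws → Path vs a b → Path ws a b
  widen vs⊆ws (path c c-inj c~ start end inside) = path c c-inj c~ start end (vs⊆ws ∘ inside)

  prepend : ∀ {vs v a b} → v ∉ vs → v ~ a → Path vs a b → Path (v ∷ vs) v b
  prepend {vs} {v} v∉vs v~a (path c c-inj c~ start end inside) =
    path (v ∷ᶠ c) (∷ᶠ-injective c≢v c-inj) v∷c~ refl end v∷c-inside
    where
    c≢v : ∀ i → c i ≢ v
    c≢v i refl = v∉vs (inside i)
    v∷c~ : ∀ i → (v ∷ᶠ c) (inject₁ i) ~ (v ∷ᶠ c) (suc i)
    v∷c~ zero    = subst (v ~_) (≡.sym start) v~a
    v∷c~ (suc i) = c~ i
    v∷c-inside : ∀ i → (v ∷ᶠ c) i ∈ v ∷ vs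
    v∷c-inside zero    = here refl
    v∷c-inside (suc i) = there (inside i)

  private
    opposite-inject₁ : ∀ {k} (i : Fin k) → opposite {suc k} (inject₁ i) ≡ suc (opposite i)
    opposite-inject₁ {suc k} zero    = refl
    opposite-inject₁ {suc k} (suc i) = cong inject₁ (opposite-inject₁ i)

    opposite-injective : ∀ {k} → Injective _≡_ _≡_ (opposite {k})
    opposite-injective {x = i} {j} eq =
      trans (≡.sym (Fin.opposite-involutive i)) (trans (cong opposite eq) (Fin.opposite-involutive j))

  reverse : ∀ {vs a b} → Path vs a b → Path vs b a
  reverse (path c c-inj c~ start end inside) =
    path (c ∘ opposite) (opposite-injective ∘ c-inj) reversed~ end
         (trans (cong c (Fin.opposite-involutive zero)) start) (inside ∘ opposite)
    where
    reversed~ : ∀ i → c (opposite (inject₁ i)) ~ c (opposite (suc i))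
    reversed~ i = subst (λ j → c j ~ c (opposite (suc i))) (≡.sym (opposite-inject₁ i))
                        (FinGraph.sym T (c~ (opposite i)))

  data Growth (r : Fin m) : List (Fin m) → Set where
    single : Growth r [ r ]
    extend : ∀ {vs v u} → Growth r vs → v ∉ vs → u ∈ vs → v ~ u → Growth r (v ∷ vs)

  root∈ : ∀ {r vs} → Growth r vs → r ∈ vs
  root∈ single           = here refl
  root∈ (extend g _ _ _) = there (root∈ g)

  growth-unique : ∀ {r vs} → Growth r vs → Unique vs
  growth-unique single              = [] ∷ []
  growth-unique (extend g v∉vs _ _) = ∉⇒Unique-∷ v∉vs (growth-unique g)

  growth-connected : ∀ {r vs a b} → Growth r vs → a ∈ vs → b ∈ vs → Path vs a b
  growth-connected single (here refl) (here refl) = trivial-path (here refl)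
  growth-connected {vs = v ∷ vs} (extend g v∉vs u∈vs v~u) = connect
    where
    from-v : ∀ {b} → b ∈ vs → Path (v ∷ vs) v b
    from-v b∈vs = prepend v∉vs v~u (growth-connected g u∈vs b∈vs)
    connect : ∀ {a b} → a ∈ v ∷ vs → b ∈ v ∷ vs → Path (v ∷ vs) a b
    connect (here refl)  (here refl)  = trivial-path (here refl)
    connect (here refl)  (there b∈vs) = from-v b∈vs
    connect (there a∈vs) (here refl)  = reverse (from-v a∈vs)
    connect (there a∈vs) (there b∈vs) = widen there (growth-connected g a∈vs b∈vs)

  exit : ∀ {vs a x} → Star _~_ a x → a ∈ vs → x ∉ vs → ∃₂ λ u v → u ∈ vs × v ∉ vs × u ~ v
  exit ε                     a∈vs x∉vs = contradiction a∈vs x∉vs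
  exit {vs} (_◅_ {j = b} a~b walk) a∈vs x∉vs with b ∈? vs
  ... | yes b∈vs = exit walk b∈vs x∉vs
  ... | no  b∉vs = _ , b , a∈vs , b∉vs , a~b

  spanning-growth : ∀ r → (∀ x → Star _~_ r x) → ∃ λ vs → Growth r vs × (∀ x → x ∈ vs)
  spanning-growth r reach = grow m single (ℕ.m≤n+m m 1)
    where
    grow : ∀ fuel {vs} → Growth r vs → m ≤ length vs + fuel → ∃ λ ws → Growth r ws × (∀ x → x ∈ ws)
    grow fuel {vs} g bound with Fin.all? (_∈? vs)
    ... | yes vs∋ = vs , g , vs∋
    ... | no ¬vs∋ with Fin.¬∀⟶∃¬ m (_∈ vs) (_∈? vs) ¬vs∋
    grow zero       g bound | no _ | x , x∉vs =
      contradiction (ℕ.≤-trans bound (ℕ.≤-reflexive (ℕ.+-identityʳ _)))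
                    (ℕ.<⇒≱ (unique⇒length≤ (∉⇒Unique-∷ x∉vs (growth-unique g))))
    grow (suc fuel) {vs} g bound | no _ | x , x∉vs with exit (reach x) (root∈ g) x∉vs
    ... | u , v , u∈vs , v∉vs , u~v =
      grow fuel (extend g v∉vs u∈vs (FinGraph.sym T u~v)) (subst (m ≤_) (ℕ.+-suc (length vs) fuel) bound)

  cycle-through : ∀ {vs v a b} → v ∉ vs → v ~ a → b ~ v → a ≢ b → Path vs a b → HasCycle (toGraph T)
  cycle-through v∉vs v~a b~v a≢b (path {zero} _ _ _ start end _) =
    contradiction (trans (≡.sym start) end) a≢b
  cycle-through v∉vs v~a b~v a≢b p@(path {suc k} _ _ _ _ _ _) =
    k , vertex , injective , consecutive , subst (_~ _) (≡.sym end) b~v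
    where open Path (prepend v∉vs v~a p)

  Leaf : Fin m → Fin m → Set
  Leaf ℓ p = ℓ ~ p × (∀ {y} → ℓ ~ y → y ≡ p)

  LeafIn : List (Fin m) → Fin m → Fin m → Set
  LeafIn vs ℓ p = ℓ ∈ vs × ℓ ~ p × (∀ {y} → y ∈ vs → ℓ ~ y → y ≡ p)

  StarIn : List (Fin m) → Fin m → Set
  StarIn vs r = (∀ {x} → x ∈ vs → x ≢ r → x ~ r) × (∀ {a b} → a ∈ vs → b ∈ vs → a ~ b → a ≡ r ⊎ b ≡ r)

  leafIn-spanning : ∀ {vs ℓ p} → (∀ x → x ∈ vs) → LeafIn vs ℓ p → Leaf ℓ p
  leafIn-spanning vs∋ (_ , ℓ~p , only-p) = ℓ~p , only-p (vs∋ _)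

  leaf-≢-parent : ∀ {ℓ p} → Leaf ℓ p → ℓ ≢ p
  leaf-≢-parent (ℓ~p , _) refl = FinGraph.irrefl T ℓ~p

  leaves-distinct : ∀ {ℓ p w q} → Leaf ℓ p → Leaf w q → p ≢ q → ℓ ≢ w
  leaves-distinct (_ , only-p) (w~q , _) p≢q refl = p≢q (≡.sym (only-p w~q))

  leaf-parent∈ : ∀ {r vs ℓ p} → Growth r vs → Leaf ℓ p → ℓ ∈ vs → ℓ ≢ r → p ∈ vs
  leaf-parent∈ single                _            (here refl)  ℓ≢r = contradiction refl ℓ≢r
  leaf-parent∈ (extend _ _ u∈vs v~u) (_ , only-p) (here refl)  _   = subst (_∈ _) (only-p v~u) (there u∈vs)
  leaf-parent∈ (extend g _ _ _)      leaf         (there ℓ∈vs) ℓ≢r = there (leaf-parent∈ g leaf ℓ∈vs ℓ≢r)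

  drop-leaf : ∀ {r vs ℓ p} → Growth r vs → Leaf ℓ p → ℓ ≢ r →
              ∃ λ ws → Growth r ws × ws ⊆ vs × ℓ ∉ ws × (∀ {x} → x ∈ vs → x ≢ ℓ → x ∈ ws)
  drop-leaf {r} single _ ℓ≢r = [ r ] , single , id , (λ { (here refl) → ℓ≢r refl }) , λ x∈ _ → x∈
  drop-leaf {ℓ = ℓ} (extend {vs} {v} {u} g v∉vs u∈vs v~u) leaf@(_ , only-p) ℓ≢r with v Fin.≟ ℓ
  ... | yes refl =
    vs , g , there , v∉vs , λ { (here refl) v≢v → contradiction refl v≢v ; (there x∈vs) _ → x∈vs }
  ... | no v≢ℓ with drop-leaf g leaf ℓ≢r
  ...   | ws , g′ , ws⊆vs , ℓ∉ws , keeps =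
    v ∷ ws , extend g′ (v∉vs ∘ ws⊆vs) (keeps u∈vs u≢ℓ) v~u , v∷ws⊆ , ℓ∉v∷ws , v∷keeps
    where
    u≢ℓ : u ≢ ℓ
    u≢ℓ refl = v∉vs (subst (_∈ vs) (≡.sym (only-p (FinGraph.sym T v~u))) (leaf-parent∈ g leaf u∈vs ℓ≢r))
    v∷ws⊆ : v ∷ ws ⊆ v ∷ vs
    v∷ws⊆ (here refl) = here refl
    v∷ws⊆ (there x∈ws) = there (ws⊆vs x∈ws)
    ℓ∉v∷ws : ℓ ∉ v ∷ ws
    ℓ∉v∷ws (here ℓ≡v) = v≢ℓ (≡.sym ℓ≡v)
    ℓ∉v∷ws (there ℓ∈ws) = ℓ∉ws ℓ∈ws
    v∷keeps : ∀ {x} → x ∈ v ∷ vs → x ≢ ℓ → x ∈ v ∷ ws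
    v∷keeps (here refl) _ = here refl
    v∷keeps (there x∈vs) x≢ℓ = there (keeps x∈vs x≢ℓ)

  module _ (acyclic : ¬ HasCycle (toGraph T)) where

    attachment-unique : ∀ {r vs v u b} → Growth r vs → v ∉ vs → u ∈ vs → b ∈ vs → v ~ u → v ~ b → b ≡ u
    attachment-unique {u = u} {b} g v∉vs u∈vs b∈vs v~u v~b with b Fin.≟ u
    ... | yes b≡u = b≡u
    ... | no  b≢u = contradiction
      (cycle-through v∉vs v~u (FinGraph.sym T v~b) (b≢u ∘ ≡.sym) (growth-connected g u∈vs b∈vs)) acyclic

    newest-leaf : ∀ {r vs v u} → Growth r vs → v ∉ vs → u ∈ vs → v ~ u → LeafIn (v ∷ vs) v u
    newest-leaf g v∉vs u∈vs v~u = here refl , v~u , only-u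
      where
      only-u : ∀ {y} → y ∈ _ → _ ~ y → y ≡ _
      only-u (here refl)  v~v = contradiction v~v (FinGraph.irrefl T)
      only-u (there y∈vs) v~y = attachment-unique g v∉vs u∈vs y∈vs v~u v~y

    star-or-leaf : ∀ {r vs} → Growth r vs → StarIn vs r ⊎ ∃₂ λ w q → w ≢ r × q ≢ r × LeafIn vs w q
    star-or-leaf single =
      inj₁ ((λ { (here refl) r≢r → contradiction refl r≢r }) , λ { (here refl) _ _ → inj₁ refl })
    star-or-leaf {r} (extend {vs} {v} {u} g v∉vs u∈vs v~u) with u Fin.≟ r | star-or-leaf g
    ... | no u≢r   | _ = inj₂ (v , u , (λ { refl → v∉vs (root∈ g) }) , u≢r , newest-leaf g v∉vs u∈vs v~u)
    ... | yes refl | inj₁ (spokes , touching) = inj₁ (spokes′ , touching′)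
      where
      spokes′ : ∀ {x} → x ∈ v ∷ vs → x ≢ u → x ~ u
      spokes′ (here refl)  _ = v~u
      spokes′ (there x∈vs) = spokes x∈vs
      touching′ : ∀ {a b} → a ∈ v ∷ vs → b ∈ v ∷ vs → a ~ b → a ≡ u ⊎ b ≡ u
      touching′ (here refl)  (here refl)  v~v = contradiction v~v (FinGraph.irrefl T)
      touching′ (here refl)  (there b∈vs) v~b = inj₂ (attachment-unique g v∉vs u∈vs b∈vs v~u v~b)
      touching′ (there a∈vs) (here refl)  a~v =
        inj₁ (attachment-unique g v∉vs u∈vs a∈vs v~u (FinGraph.sym T a~v))
      touching′ (there a∈vs) (there b∈vs) = touching a∈vs b∈vs
    ... | yes refl | inj₂ (w , q , w≢u , q≢u , (w∈vs , w~q , only-q)) =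
      inj₂ (w , q , w≢u , q≢u , there w∈vs , w~q , only-q′)
      where
      only-q′ : ∀ {y} → y ∈ v ∷ vs → w ~ y → y ≡ q
      only-q′ (here refl)  w~v =
        contradiction (attachment-unique g v∉vs u∈vs w∈vs v~u (FinGraph.sym T w~v)) w≢u
      only-q′ (there y∈vs) = only-q y∈vs

module Trees {n : ℕ} (T : FinGraph (suc n)) (connected : ∀ i j → Connected (toGraph T) i j)
             (acyclic : ¬ HasCycle (toGraph T)) where

  open Growths T public

  non-star⇒leaf : ¬ T ≅ Star-K1 (suc n) → ∀ r → ∃₂ λ w q → Leaf w q × w ≢ r × q ≢ r
  non-star⇒leaf not-star r with spanning-growth r (connected r)
  ... | vs , g , vs∋ with star-or-leaf acyclic g
  ... | inj₁ (spokes , touching) =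
    contradiction (centred⇒≅star T r (spokes (vs∋ _)) (touching (vs∋ _) (vs∋ _))) not-star
  ... | inj₂ (w , q , w≢r , q≢r , leaf) = w , q , leafIn-spanning vs∋ leaf , w≢r , q≢r

  record TwoLeavesPruned : Set where
    field
      {ℓ p w q}  : Fin (suc n)
      leaf-ℓ     : Leaf ℓ p
      leaf-w     : Leaf w q
      p≢q        : p ≢ q
      {Q}        : List (Fin (suc n))
      growth     : Growth p Q
      ℓ∉Q        : ℓ ∉ Q
      w∉ℓ∷Q      : w ∉ ℓ ∷ Q
      q∈Q        : q ∈ Q
      covers     : ∀ x → x ∈ w ∷ ℓ ∷ Q

  prune-two-leaves : ¬ T ≅ Star-K1 (suc n) → TwoLeavesPruned
  prune-two-leaves not-star
    with ℓ , p , leaf-ℓ , _ , _         ← non-star⇒leaf not-star zero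
    with w , q , leaf-w , w≢p , q≢p    ← non-star⇒leaf not-star p
    with vs , g , vs∋                  ← spanning-growth p (connected p)
    with vs′ , g′ , _ , ℓ∉vs′ , keeps′ ← drop-leaf g leaf-ℓ (leaf-≢-parent leaf-ℓ)
    with Q , g″ , Q⊆vs′ , w∉Q , keeps″ ← drop-leaf g′ leaf-w w≢p =
    record { leaf-ℓ = leaf-ℓ ; leaf-w = leaf-w ; p≢q = ≢-sym q≢p ; growth = g″
           ; ℓ∉Q = ℓ∉vs′ ∘ Q⊆vs′ ; w∉ℓ∷Q = w∉ℓ∷Q ; q∈Q = keeps q≢ℓ (leaf-≢-parent leaf-w ∘ ≡.sym)
           ; covers = covers }
    where
    keeps : ∀ {x} → x ≢ ℓ → x ≢ w → x ∈ Q
    keeps x≢ℓ x≢w = keeps″ (keeps′ (vs∋ _) x≢ℓ) x≢w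
    w≢ℓ : w ≢ ℓ
    w≢ℓ = leaves-distinct leaf-w leaf-ℓ q≢p
    q≢ℓ : q ≢ ℓ
    q≢ℓ refl = w≢p (proj₂ leaf-ℓ (FinGraph.sym T (proj₁ leaf-w)))
    w∉ℓ∷Q : w ∉ ℓ ∷ Q
    w∉ℓ∷Q (here w≡ℓ)   = w≢ℓ w≡ℓ
    w∉ℓ∷Q (there w∈Q) = w∉Q w∈Q
    covers : ∀ x → x ∈ w ∷ ℓ ∷ Q
    covers x with x Fin.≟ w | x Fin.≟ ℓ
    ... | yes refl | _        = here refl
    ... | no _     | yes refl = there (here refl)
    ... | no x≢w   | no x≢ℓ   = there (there (keeps x≢ℓ x≢w))

record AlmostComplete (N : ℕ) : Set₁ where
  field
    graph                : FinGraph N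
    adj?                 : ∀ x y → Dec (adj graph x y)
    non-neighbour-unique : ∀ {x y z} → y ≢ x → z ≢ x → ¬ adj graph x y → ¬ adj graph x z → y ≡ z

module Embedding {n N : ℕ} (T : FinGraph (suc n)) (connected : ∀ i j → Connected (toGraph T) i j)
                 (acyclic : ¬ HasCycle (toGraph T)) (H : AlmostComplete N) where

  open Trees T connected acyclic
  open AlmostComplete H

  infix 4 _~ᴴ_
  _~ᴴ_ : Fin N → Fin N → Set
  _~ᴴ_ = adj graph

  adjacent-unless : ∀ {x y z} → y ≢ x → z ≢ x → y ≢ z → ¬ x ~ᴴ y → x ~ᴴ z
  adjacent-unless {x} {z = z} y≢x z≢x y≢z ¬x~y with adj? x z
  ... | yes x~z = x~z
  ... | no ¬x~z = contradiction (non-neighbour-unique y≢x z≢x ¬x~y ¬x~z) y≢z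

  adjacent-to-one : ∀ {x y z} → y ≢ x → z ≢ x → y ≢ z → x ~ᴴ y ⊎ x ~ᴴ z
  adjacent-to-one {x} {y} y≢x z≢x y≢z with adj? x y
  ... | yes x~y = inj₁ x~y
  ... | no ¬x~y = inj₂ (adjacent-unless y≢x z≢x y≢z ¬x~y)

  matched : ∀ {a b x y} → a ≢ b → x ≢ y → x ≢ a → x ≢ b → y ≢ a → y ≢ b →
            (a ~ᴴ x × b ~ᴴ y) ⊎ (a ~ᴴ y × b ~ᴴ x)
  matched {a} {b} {x} {y} a≢b x≢y x≢a x≢b y≢a y≢b with adj? a x | adj? b y
  ... | yes a~x | yes b~y = inj₁ (a~x , b~y)
  ... | no ¬a~x | _       = inj₂ ( adjacent-unless x≢a y≢a x≢y ¬a~x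
                                 , FinGraph.sym graph (adjacent-unless (≢-sym x≢a) (≢-sym x≢b) a≢b
                                                                       (¬a~x ∘ FinGraph.sym graph)))
  ... | yes _   | no ¬b~y = inj₂ ( FinGraph.sym graph (adjacent-unless (≢-sym y≢b) (≢-sym y≢a) (≢-sym a≢b)
                                                                       (¬b~y ∘ FinGraph.sym graph))
                                 , adjacent-unless y≢b x≢b (≢-sym x≢y) ¬b~y)

  record EmbedsOn (Q : List (Fin (suc n))) (φ : Fin (suc n) → Fin N) : Set where
    field
      injective : ∀ {a b} → a ∈ Q → b ∈ Q → φ a ≡ φ b → a ≡ b
      preserves : ∀ {a b} → a ∈ Q → b ∈ Q → a ~ b → φ a ~ᴴ φ b
  open EmbedsOn

  embeds-singleton : ∀ r φ → EmbedsOn [ r ] φ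
  embeds-singleton r φ = record
    { injective = λ { (here refl) (here refl) _ → refl }
    ; preserves = λ { (here refl) (here refl) r~r → contradiction r~r (FinGraph.irrefl T) }
    }

  spanning-copy : ∀ {Q φ} → EmbedsOn Q φ → (∀ x → x ∈ Q) → ContainsCopy (toGraph graph) T
  spanning-copy {φ = φ} e Q∋ = φ , injective e (Q∋ _) (Q∋ _) , λ a b → preserves e (Q∋ a) (Q∋ b)

  Unused : List (Fin (suc n)) → (Fin (suc n) → Fin N) → Fin N → Set
  Unused Q φ s = ∀ {b} → b ∈ Q → φ b ≢ s

  two-unused : ∀ Q φ → 2 + length Q ≤ N → ∃₂ λ s t → s ≢ t × Unused Q φ s × Unused Q φ t
  two-unused Q φ bound with ∃₂∉ (map φ Q) (subst (λ l → 2 + l ≤ N) (≡.sym (length-map φ Q)) bound)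
  ... | s , t , s≢t , s∉ , t∉ = s , t , s≢t , unused s∉ , unused t∉
    where
    unused : ∀ {s} → s ∉ map φ Q → Unused Q φ s
    unused s∉ b∈Q refl = s∉ (∈-map⁺ φ b∈Q)

  unused-neighbour : ∀ {Q φ u} → 2 + length Q ≤ N → u ∈ Q → ∃ λ s → Unused Q φ s × s ~ᴴ φ u
  unused-neighbour {Q} {φ} bound u∈Q with two-unused Q φ bound
  ... | s , t , s≢t , s-unused , t-unused
      with adjacent-to-one (≢-sym (s-unused u∈Q)) (≢-sym (t-unused u∈Q)) s≢t
  ... | inj₁ φu~s = s , s-unused , FinGraph.sym graph φu~s
  ... | inj₂ φu~t = t , t-unused , FinGraph.sym graph φu~t

  unused-matching : ∀ {Q φ p q} → EmbedsOn Q φ → 2 + length Q ≤ N → p ∈ Q → q ∈ Q → p ≢ q →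
                    ∃₂ λ s t → s ≢ t × Unused Q φ s × Unused Q φ t × s ~ᴴ φ p × t ~ᴴ φ q
  unused-matching {Q} {φ} e bound p∈Q q∈Q p≢q with two-unused Q φ bound
  ... | s , t , s≢t , s-unused , t-unused
      with matched (p≢q ∘ injective e p∈Q q∈Q) s≢t (≢-sym (s-unused p∈Q)) (≢-sym (s-unused q∈Q))
                   (≢-sym (t-unused p∈Q)) (≢-sym (t-unused q∈Q))
  ... | inj₁ (φp~s , φq~t) = s , t , s≢t , s-unused , t-unused ,
                             FinGraph.sym graph φp~s , FinGraph.sym graph φq~t
  ... | inj₂ (φp~t , φq~s) = t , s , ≢-sym s≢t , t-unused , s-unused ,
                             FinGraph.sym graph φp~t , FinGraph.sym graph φq~s

  infixl 6 _[_]≔_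
  _[_]≔_ : (Fin (suc n) → Fin N) → Fin (suc n) → Fin N → Fin (suc n) → Fin N
  φ [ v ]≔ s = updateAt φ v (const s)

  updated-elsewhere : ∀ {Q v b} φ s → v ∉ Q → b ∈ Q → (φ [ v ]≔ s) b ≡ φ b
  updated-elsewhere {v = v} φ s v∉Q b∈Q = updateAt-minimal _ v φ λ { refl → v∉Q b∈Q }

  unused-after : ∀ {Q φ v s t} → v ∉ Q → s ≢ t → Unused Q φ t → Unused (v ∷ Q) (φ [ v ]≔ s) t
  unused-after {φ = φ} {v} _ s≢t _ (here refl) = s≢t ∘ trans (≡.sym (updateAt-updates v φ))
  unused-after {φ = φ} {s = s} v∉Q _ t-unused (there b∈Q) =
    t-unused b∈Q ∘ trans (≡.sym (updated-elsewhere φ s v∉Q b∈Q))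

  attach : ∀ {Q φ v u s} → EmbedsOn Q φ → v ∉ Q → (∀ {b} → b ∈ Q → v ~ b → b ≡ u) →
           Unused Q φ s → s ~ᴴ φ u → EmbedsOn (v ∷ Q) (φ [ v ]≔ s)
  attach {Q} {φ} {v} {u} {s} e v∉Q only-u s-unused s~φu = record { injective = inj ; preserves = pres }
    where
    ψ = φ [ v ]≔ s
    ψ-new : ψ v ≡ s
    ψ-new = updateAt-updates v φ
    ψ-old : ∀ {b} → b ∈ Q → ψ b ≡ φ b
    ψ-old = updated-elsewhere φ s v∉Q
    ψ-new≢old : ∀ {b} → b ∈ Q → ψ v ≢ ψ b
    ψ-new≢old b∈Q ψv≡ψb = s-unused b∈Q (trans (≡.sym (ψ-old b∈Q)) (trans (≡.sym ψv≡ψb) ψ-new))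
    inj : ∀ {a b} → a ∈ v ∷ Q → b ∈ v ∷ Q → ψ a ≡ ψ b → a ≡ b
    inj (here refl)  (here refl)  _  = refl
    inj (here refl)  (there b∈Q) eq = contradiction eq (ψ-new≢old b∈Q)
    inj (there a∈Q) (here refl)  eq = contradiction (≡.sym eq) (ψ-new≢old a∈Q)
    inj (there a∈Q) (there b∈Q) eq = injective e a∈Q b∈Q (trans (≡.sym (ψ-old a∈Q)) (trans eq (ψ-old b∈Q)))
    pres-new : ∀ {b} → b ∈ Q → v ~ b → ψ v ~ᴴ ψ b
    pres-new b∈Q v~b rewrite ψ-new | ψ-old b∈Q | only-u b∈Q v~b = s~φu
    pres : ∀ {a b} → a ∈ v ∷ Q → b ∈ v ∷ Q → a ~ b → ψ a ~ᴴ ψ b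
    pres (here refl)  (here refl)  v~v = contradiction v~v (FinGraph.irrefl T)
    pres (here refl)  (there b∈Q) v~b = pres-new b∈Q v~b
    pres (there a∈Q) (here refl)  a~v = FinGraph.sym graph (pres-new a∈Q (FinGraph.sym T a~v))
    pres (there a∈Q) (there b∈Q) a~b rewrite ψ-old a∈Q | ψ-old b∈Q = preserves e a∈Q b∈Q a~b

  embed-growth : ∀ {r vs} → Growth r vs → length vs < N → ∃ (EmbedsOn vs)
  embed-growth single (s≤s _) = const zero , embeds-singleton _ _
  embed-growth (extend g v∉vs u∈vs v~u) bound with embed-growth g (ℕ.<⇒≤ bound)
  ... | φ , e with unused-neighbour bound u∈vs
  ... | s , s-unused , s~φu =
    _ , attach e v∉vs (λ b∈vs → attachment-unique acyclic g v∉vs u∈vs b∈vs v~u) s-unused s~φu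

  embed-two-leaves : ∀ {Q φ ℓ p w q} → EmbedsOn Q φ → 2 + length Q ≤ N → Leaf ℓ p → Leaf w q →
                     ℓ ∉ Q → w ∉ ℓ ∷ Q → p ∈ Q → q ∈ Q → p ≢ q → ∃ (EmbedsOn (w ∷ ℓ ∷ Q))
  embed-two-leaves {φ = φ} e bound (_ , only-p) (_ , only-q) ℓ∉Q w∉ℓ∷Q p∈Q q∈Q p≢q
    with unused-matching e bound p∈Q q∈Q p≢q
  ... | s , t , s≢t , s-unused , t-unused , s~φp , t~φq =
    _ , attach (attach e ℓ∉Q (λ _ → only-p) s-unused s~φp) w∉ℓ∷Q (λ _ → only-q)
               (unused-after ℓ∉Q s≢t t-unused)
               (subst (t ~ᴴ_) (≡.sym (updated-elsewhere φ s ℓ∉Q q∈Q)) t~φq)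

  small-tree-embeds : suc n < N → ContainsCopy (toGraph graph) T
  small-tree-embeds bound with spanning-growth zero (connected zero)
  ... | vs , g , vs∋ =
    spanning-copy (proj₂ (embed-growth g (ℕ.≤-<-trans (unique⇒length≤ (growth-unique g)) bound))) vs∋

  non-star-embeds : suc n ≤ N → ¬ T ≅ Star-K1 (suc n) → ContainsCopy (toGraph graph) T
  non-star-embeds bound not-star = spanning-copy (proj₂ embedded) covers
    where
    open TwoLeavesPruned (prune-two-leaves not-star)
    two-slots : 2 + length Q ≤ N
    two-slots = ℕ.≤-trans (unique⇒length≤ (∉⇒Unique-∷ w∉ℓ∷Q (∉⇒Unique-∷ ℓ∉Q (growth-unique growth)))) bound
    embedded : ∃ (EmbedsOn (w ∷ ℓ ∷ Q))
    embedded = embed-two-leaves (proj₂ (embed-growth growth (ℕ.<⇒≤ two-slots))) two-slots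
                                leaf-ℓ leaf-w ℓ∉Q w∉ℓ∷Q (root∈ growth) q∈Q p≢q

copy-trans : ∀ {ℓv ℓe m N} {G : Graph ℓv ℓe} {H : FinGraph N} {T : FinGraph m} →
             ContainsCopy (toGraph H) T → ContainsCopy G H → ContainsCopy G T
copy-trans (φ , φ-injective , φ-adjacent) (ψ , ψ-injective , ψ-adjacent) =
  ψ ∘ φ , φ-injective ∘ ψ-injective , λ i j i~j → ψ-adjacent _ _ (φ-adjacent i j i~j)

component⇒almost-complete : ∀ {ℓv ℓe} (G : Graph ℓv ℓe) k → ComponentMinDeg G (suc (suc k)) k →
                            Σ (AlmostComplete (suc (suc k))) λ H → ContainsCopy G (AlmostComplete.graph H)
component⇒almost-complete G k (f , f-injective , component , min-degree) =
  H , f , f-injective , λ _ _ → ≈⇒Adj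
  where
  neighbour : Fin (suc (suc k)) → Fin k → V G
  neighbour x = proj₁ (min-degree (f x) (x , refl))
  neighbour-adjacent : ∀ x j → Adj G (f x) (neighbour x j)
  neighbour-adjacent x = proj₂ (proj₂ (min-degree (f x) (x , refl)))
  in-component : ∀ x j → ∃ λ i → f i ≡ neighbour x j
  in-component x j = Equivalence.from (component _)
    (Equivalence.to (component (f x)) (x , refl) ◅◅ (neighbour-adjacent x j ◅ ε))

  σ : Fin (suc (suc k)) → Fin k → Fin (suc (suc k))
  σ x j = proj₁ (in-component x j)
  σ-injective : ∀ x → Injective _≡_ _≡_ (σ x)
  σ-injective x {i} {j} eq = proj₁ (proj₂ (min-degree (f x) (x , refl)))
    (trans (≡.sym (proj₂ (in-component x i))) (trans (cong f eq) (proj₂ (in-component x j))))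
  σ-adjacent : ∀ x j → Adj G (f x) (f (σ x j))
  σ-adjacent x j = subst (Adj G (f x)) (≡.sym (proj₂ (in-component x j))) (neighbour-adjacent x j)
  σ≢ : ∀ x j → σ x j ≢ x
  σ≢ x j eq = Graph.irrefl G (subst (λ y → Adj G (f x) (f y)) eq (σ-adjacent x j))

  infix 4 _≈_
  _≈_ : Fin (suc (suc k)) → Fin (suc (suc k)) → Set
  x ≈ y = (∃ λ j → σ x j ≡ y) ⊎ (∃ λ j → σ y j ≡ x)
  ≈-irrefl : ∀ {x} → ¬ x ≈ x
  ≈-irrefl (inj₁ (j , eq)) = σ≢ _ j eq
  ≈-irrefl (inj₂ (j , eq)) = σ≢ _ j eq
  ≈⇒Adj : ∀ {x y} → x ≈ y → Adj G (f x) (f y)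
  ≈⇒Adj (inj₁ (j , refl)) = σ-adjacent _ j
  ≈⇒Adj (inj₂ (j , refl)) = Graph.sym G (σ-adjacent _ j)

  non-neighbour-unique : ∀ {x y z} → y ≢ x → z ≢ x → ¬ x ≈ y → ¬ x ≈ z → y ≡ z
  non-neighbour-unique {x} {y} {z} y≢x z≢x ¬x≈y ¬x≈z with y Fin.≟ z
  ... | yes y≡z = y≡z
  ... | no  y≢z = contradiction (Fin.injective⇒≤ x∷y∷z∷σx-injective) ℕ.1+n≰n
    where
    z∷σx≢y : ∀ i → (z ∷ᶠ σ x) i ≢ y
    z∷σx≢y zero    = ≢-sym y≢z
    z∷σx≢y (suc j) = ¬x≈y ∘ inj₁ ∘ (j ,_)
    y∷z∷σx≢x : ∀ i → (y ∷ᶠ z ∷ᶠ σ x) i ≢ x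
    y∷z∷σx≢x zero          = y≢x
    y∷z∷σx≢x (suc zero)    = z≢x
    y∷z∷σx≢x (suc (suc j)) = σ≢ x j
    x∷y∷z∷σx-injective : Injective _≡_ _≡_ (x ∷ᶠ y ∷ᶠ z ∷ᶠ σ x)
    x∷y∷z∷σx-injective = ∷ᶠ-injective y∷z∷σx≢x (∷ᶠ-injective z∷σx≢y
                           (∷ᶠ-injective (λ j → ¬x≈z ∘ inj₁ ∘ (j ,_)) (σ-injective x)))

  H : AlmostComplete (suc (suc k))
  H = record
    { graph = record { adj = _≈_ ; sym = Sum.swap ; irrefl = ≈-irrefl }
    ; adj? = λ x y → Fin.any? (λ j → σ x j Fin.≟ y) ⊎-dec Fin.any? (λ j → σ y j Fin.≟ x)
    ; non-neighbour-unique = non-neighbour-unique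
    }

corollary15 : ∀ {ℓv ℓe : Level} (n : ℕ) → 6 ≤ n → (G : Graph ℓv ℓe) → ComponentMinDeg G n (n ∸ 2) → (m : ℕ) → m ≤ n → (T : FinGraph m) → IsTree T → ¬ (T ≅ Star-K1 n) → ContainsCopy G T
-- The hypothesis 6 ≤ n is only used through n ≥ 2.
corollary15 (suc (suc k)) (s≤s (s≤s _)) G component (suc m) m≤n T (_ , connected , acyclic) not-star
  with H , H⊆G ← component⇒almost-complete G k component
  with ℕ.m≤n⇒m<n∨m≡n m≤n
... | inj₁ m<n  = copy-trans {G = G} {AlmostComplete.graph H} {T}
    (Embedding.small-tree-embeds T connected acyclic H m<n) H⊆G
... | inj₂ refl = copy-trans {G = G} {AlmostComplete.graph H} {T}
    (Embedding.non-star-embeds T connected acyclic H ℕ.≤-refl not-star) H⊆G
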